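{- For integers $n,k$ with $n\ge 2$ and $1\le k\le 2^{n-1}$, the number $\tau_{n,k}$ of separating families of $k$ arbitrary bipartitions over an $n$-element set is $$\tau_{n,k}=\frac{(n-1)!}{k!}\sum_{i=1}^{k}(-1)^{k-i}\left[{k \atop i}\right]\binom{2^i-1}{n-1}.$$
   Context: A bipartition of a set $S$ is a partition of $S$ into at most two nonempty components (so the trivial partition $\{S\}$ is a bipartition). A bipartition cuts two elements if they lie in different components. A family of bipartitions of $S$ is a separating family for $S$ if every two distinct elements of $S$ are cut by some bipartition in the family. $\tau_{n,k}$ is the number of separating families consisting of $k$ distinct bipartitions of a fixed $n$-element set. $\left[{k \atop i}\right]$ denotes the unsigned Stirling number of the first kind (number of permutations of $k$ elements with exactly $i$ cycles). -}

module Defs where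

open import Data.Bool using (Bool; true; false)
open import Data.Nat using (ℕ; zero; suc; _*_; _+_; _∸_)
open import Data.Fin using (Fin)
open import Data.Fin.Properties using (all?; any?)
open import Data.Vec using (Vec; []; _∷_; lookup)
open import Data.List using (List; []; _∷_; map; _++_; length; filter; upTo)
open import Data.List.Relation.Unary.Any using (Any)
import Data.List.Relation.Unary.Any as Any
open import Data.Integer as ℤ using (ℤ; +_)
open import Data.Bool.Properties using () renaming (_≟_ to _≟B_)
open import Data.Fin.Properties using () renaming (_≟_ to _≟F_)
open import Relation.Binary.PropositionalEquality using (_≡_; _≢_)
open import Relation.Nullary using (Dec; yes; no; ¬_)
open import Relation.Nullary.Decidable using (_→-dec_; ¬?)

-- Ground set: Fin (suc m), an n-element set with n = suc m.
-- A bipartition of Fin (suc m) (into at most two nonempty blocks, the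
-- trivial one included) is uniquely encoded by the 2-colouring of its
-- elements normalised so that element 0 gets colour false.
-- Bip m stores the colours of elements 1..m.  Distinct Bip values are
-- exactly distinct bipartitions; there are 2^m of them.
Bip : ℕ → Set
Bip m = Vec Bool m

colour : ∀ {m} → Bip m → Fin (suc m) → Bool
colour b i = lookup (false ∷ b) i

Cuts : ∀ {m} → Bip m → Fin (suc m) → Fin (suc m) → Set
Cuts b i j = colour b i ≢ colour b j

Separating : ∀ {m} → List (Bip m) → Set
Separating {m} F = ∀ (i j : Fin (suc m)) → i ≢ j → Any (λ b → Cuts b i j) F

separating? : ∀ {m} (F : List (Bip m)) → Dec (Separating F)
separating? F = all? λ i → all? λ j →
  ¬? (i ≟F j) →-dec Any.any? (λ b → ¬? (colour b i ≟B colour b j)) F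

allBips : (m : ℕ) → List (Bip m)
allBips zero = [] ∷ []
allBips (suc m) = map (false ∷_) (allBips m) ++ map (true ∷_) (allBips m)

-- all sublists (= all subsets of a duplicate-free list, each once)
sublists : ∀ {A : Set} → List A → List (List A)
sublists [] = [] ∷ []
sublists (x ∷ xs) = sublists xs ++ map (x ∷_) (sublists xs)

families : (m k : ℕ) → List (List (Bip m))
families m k = filter (λ F → length F Data.Nat.≟ k) (sublists (allBips m))

-- τ_{n,k} with n = suc m
τ : (m k : ℕ) → ℕ
τ m k = length (filter separating? (families m k))

stirling1 : ℕ → ℕ → ℕ
stirling1 zero zero = 1
stirling1 zero (suc i) = 0
stirling1 (suc k) zero = 0
stirling1 (suc k) (suc i) = k * stirling1 k (suc i) + stirling1 k i

sgn : ℕ → ℤ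
sgn zero = ℤ.+ 1
sgn (suc e) = ℤ.- sgn e

sum1to : ℕ → (ℕ → ℤ) → ℤ
sum1to zero f = ℤ.+ 0
sum1to (suc k) f = sum1to k f ℤ.+ f (suc k)

-- A sequence of i bipartitions of {0, …, m} gives every element its column of
-- colours in Bool^i, and the sequence separates exactly when these m + 1 columns
-- are distinct.  Element 0 always has the zero column, so separating sequences
-- correspond to injections of the other m elements into the 2^i − 1 nonzero
-- columns: there are m! C(2^i − 1, m) of them.
-- To pass from sequences to sets, let Q be any weight on families that depends
-- only on the underlying set.  The i-sequences count each set S once for every
-- surjection of positions onto S, and the signed Stirling numbers of the first
-- kind invert this: k! times the weight of the k-sets is Σᵢ s(k, i) times the
-- weight of the i-sequences.  By induction on k this reduces to the recurrence
-- s(k+1, i+1) = s(k, i) − k s(k, i+1).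
module Submission where

open import Defs
open import Data.Bool using (Bool; true; false)
open import Data.Bool.Properties using () renaming (_≟_ to _≟ᴮ_)
open import Data.Empty using (⊥-elim)
open import Data.Fin using (Fin; punchOut) renaming (zero to fzero; suc to fsuc)
import Data.Fin.Properties as Fin
open import Data.Integer as ℤ using (ℤ; +_)
import Data.Integer.Properties as ℤ
import Data.Integer.Tactic.RingSolver as ℤ-Solver
open import Data.List using (List; []; _∷_; _++_; map; length; filter)
open import Data.List.Relation.Binary.Subset.Propositional using (_⊆_)
open import Data.List.Relation.Binary.Subset.Propositional.Properties
  using (⊆-refl; xs⊆x∷xs; ∷⁺ʳ; ∈-∷⁺ʳ; Any-resp-⊆)
open import Data.List.Relation.Unary.Any using (Any; here; there)
open import Data.Nat as ℕ using (ℕ; zero; suc; _+_; _*_; _∸_; _^_; _!; _<_; _≤_; s≤s)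
import Data.Nat.Properties as ℕ
import Data.Nat.Tactic.RingSolver as ℕ-Solver
import Algebra.Properties.CommutativeSemigroup ℕ.+-commutativeSemigroup as ℕ+
import Algebra.Properties.CommutativeSemigroup ℕ.*-commutativeSemigroup as ℕ*
import Algebra.Properties.CommutativeSemigroup ℤ.+-commutativeSemigroup as ℤ+
open import Data.Nat.Combinatorics
  using (_C_; k>n⇒nCk≡0; nCk≡n!/k![n-k]!; k![n∸k]!∣n!; [n-k]*[n-k-1]!≡[n-k]!)
open import Data.Nat.DivMod using (m/n*n≡m)
open import Data.Product using (_×_; _,_)
open import Data.Sum using (_⊎_; inj₁; inj₂)
open import Data.Vec as Vec using (Vec; []; _∷_; toList; zipWith)
import Data.Vec.Properties as Vec
open import Data.Vec.Functional using (insertAt)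
open import Data.Vec.Functional.Properties using (insertAt-lookup; insertAt-punchIn)
open import Function using (_∘_)
open import Function.Definitions using (Injective)
open import Relation.Nullary using (Dec; yes; no; ¬_)
open import Relation.Nullary.Decidable using (_×-dec_; ¬?)
open import Relation.Unary using (Decidable)
open import Relation.Binary.PropositionalEquality
  using (_≡_; _≢_; refl; sym; trans; cong; cong₂; module ≡-Reasoning)

∑ : {A : Set} → List A → (A → ℕ) → ℕ
∑ [] f = 0
∑ (x ∷ xs) f = f x + ∑ xs f

module _ {A : Set} where

  ∑-cong : ∀ (xs : List A) {f g : A → ℕ} → (∀ x → f x ≡ g x) → ∑ xs f ≡ ∑ xs g
  ∑-cong [] eq = refl
  ∑-cong (x ∷ xs) eq = cong₂ _+_ (eq x) (∑-cong xs eq)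

  ∑-≡0 : ∀ (xs : List A) {f : A → ℕ} → (∀ x → f x ≡ 0) → ∑ xs f ≡ 0
  ∑-≡0 [] eq = refl
  ∑-≡0 (x ∷ xs) eq = cong₂ _+_ (eq x) (∑-≡0 xs eq)

  ∑-++ : ∀ (xs ys : List A) (f : A → ℕ) → ∑ (xs ++ ys) f ≡ ∑ xs f + ∑ ys f
  ∑-++ [] ys f = refl
  ∑-++ (x ∷ xs) ys f = trans (cong (_+_ (f x)) (∑-++ xs ys f)) (sym (ℕ.+-assoc (f x) _ _))

  ∑-map : ∀ {B : Set} (h : A → B) (xs : List A) (f : B → ℕ) → ∑ (map h xs) f ≡ ∑ xs (f ∘ h)
  ∑-map h [] f = refl
  ∑-map h (x ∷ xs) f = cong (_+_ (f (h x))) (∑-map h xs f)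

  ∑-+ : ∀ (xs : List A) (f g : A → ℕ) → ∑ xs (λ x → f x + g x) ≡ ∑ xs f + ∑ xs g
  ∑-+ [] f g = refl
  ∑-+ (x ∷ xs) f g = trans (cong (_+_ (f x + g x)) (∑-+ xs f g)) (ℕ+.interchange (f x) (g x) _ _)

  ∑-*ˡ : ∀ (xs : List A) (c : ℕ) (f : A → ℕ) → ∑ xs (λ x → c * f x) ≡ c * ∑ xs f
  ∑-*ˡ [] c f = sym (ℕ.*-zeroʳ c)
  ∑-*ˡ (x ∷ xs) c f = trans (cong (_+_ (c * f x)) (∑-*ˡ xs c f)) (sym (ℕ.*-distribˡ-+ c (f x) _))

  length≡∑1 : ∀ (xs : List A) → length xs ≡ ∑ xs (λ _ → 1)
  length≡∑1 [] = refl
  length≡∑1 (x ∷ xs) = cong suc (length≡∑1 xs)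

indicator : {X : Set} → Dec X → ℕ
indicator (yes _) = 1
indicator (no _) = 0

module _ {X Y : Set} where

  indicator-cong : (X → Y) → (Y → X) → (d : Dec X) (e : Dec Y) → indicator d ≡ indicator e
  indicator-cong f g (yes x) (yes y) = refl
  indicator-cong f g (yes x) (no ¬y) = ⊥-elim (¬y (f x))
  indicator-cong f g (no ¬x) (yes y) = ⊥-elim (¬x (g y))
  indicator-cong f g (no ¬x) (no ¬y) = refl

  indicator-× : (d : Dec X) (e : Dec Y) → indicator (d ×-dec e) ≡ indicator d * indicator e
  indicator-× (yes x) (yes y) = refl
  indicator-× (yes x) (no ¬y) = refl
  indicator-× (no ¬x) e = refl

module _ {X : Set} where

  indicator-yes : X → (d : Dec X) → indicator d ≡ 1
  indicator-yes x (yes _) = refl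
  indicator-yes x (no ¬x) = ⊥-elim (¬x x)

  indicator-no : ¬ X → (d : Dec X) → indicator d ≡ 0
  indicator-no ¬x (yes x) = ⊥-elim (¬x x)
  indicator-no ¬x (no _) = refl

∑-filter : ∀ {A : Set} {P : A → Set} (P? : Decidable P) (xs : List A) (w : A → ℕ) →
  ∑ (filter P? xs) w ≡ ∑ xs (λ x → indicator (P? x) * w x)
∑-filter P? [] w = refl
∑-filter P? (x ∷ xs) w with P? x
... | yes _ = cong₂ _+_ (sym (ℕ.+-identityʳ (w x))) (∑-filter P? xs w)
... | no _ = ∑-filter P? xs w

module _ {A : Set} where

  -- The k-subsets of U are chosen by position: for duplicate-free U these are its k-element subsets.
  ∑Subsets : List A → ℕ → (List A → ℕ) → ℕ
  ∑Subsets U zero Q = Q []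
  ∑Subsets [] (suc k) Q = 0
  ∑Subsets (y ∷ U) (suc k) Q = ∑Subsets U (suc k) Q + ∑Subsets U k (Q ∘ (y ∷_))

  ∑Subsets-cong : ∀ (U : List A) k {Q R : List A → ℕ} → (∀ S → Q S ≡ R S) →
    ∑Subsets U k Q ≡ ∑Subsets U k R
  ∑Subsets-cong U zero eq = eq []
  ∑Subsets-cong [] (suc k) eq = refl
  ∑Subsets-cong (y ∷ U) (suc k) eq =
    cong₂ _+_ (∑Subsets-cong U (suc k) eq) (∑Subsets-cong U k (eq ∘ (y ∷_)))

  ∑-sublists-length : ∀ (U : List A) k (Q : List A → ℕ) →
    ∑ (sublists U) (λ S → indicator (length S ℕ.≟ k) * Q S) ≡ ∑Subsets U k Q
  ∑-sublists-length [] zero Q = trans (ℕ.+-identityʳ _) (ℕ.+-identityʳ (Q []))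
  ∑-sublists-length [] (suc k) Q = refl
  ∑-sublists-length (y ∷ U) k Q = begin
      ∑ (sublists U ++ map (y ∷_) (sublists U)) (λ S → indicator (length S ℕ.≟ k) * Q S)
    ≡⟨ ∑-++ (sublists U) _ _ ⟩
      ∑ (sublists U) (λ S → indicator (length S ℕ.≟ k) * Q S)
        + ∑ (map (y ∷_) (sublists U)) (λ S → indicator (length S ℕ.≟ k) * Q S)
    ≡⟨ cong₂ _+_ (∑-sublists-length U k Q) (∑-map (y ∷_) (sublists U) _) ⟩
      ∑Subsets U k Q + ∑ (sublists U) (λ S → indicator (suc (length S) ℕ.≟ k) * Q (y ∷ S))
    ≡⟨ add-sublists-with-y k ⟩
      ∑Subsets (y ∷ U) k Q
    ∎
    where
    open ≡-Reasoning
    add-sublists-with-y : ∀ k →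
      ∑Subsets U k Q + ∑ (sublists U) (λ S → indicator (suc (length S) ℕ.≟ k) * Q (y ∷ S))
      ≡ ∑Subsets (y ∷ U) k Q
    add-sublists-with-y zero = trans (cong (_+_ (Q [])) (∑-≡0 (sublists U) (λ S →
        cong (_* Q (y ∷ S)) (indicator-no (λ ()) (suc (length S) ℕ.≟ 0)))))
      (ℕ.+-identityʳ (Q []))
    add-sublists-with-y (suc k) = cong (_+_ (∑Subsets U (suc k) Q)) (trans
      (∑-cong (sublists U) (λ S → cong (_* Q (y ∷ S))
        (indicator-cong ℕ.suc-injective (cong suc) (suc (length S) ℕ.≟ suc k) (length S ℕ.≟ k))))
      (∑-sublists-length U k (Q ∘ (y ∷_))))

  ∑Vec : List A → (i : ℕ) → (Vec A i → ℕ) → ℕ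
  ∑Vec U zero f = f []
  ∑Vec U (suc i) f = ∑ U (λ x → ∑Vec U i (f ∘ (x ∷_)))

  ∑Vec-cong : ∀ (U : List A) i {f g : Vec A i → ℕ} → (∀ e → f e ≡ g e) → ∑Vec U i f ≡ ∑Vec U i g
  ∑Vec-cong U zero eq = eq []
  ∑Vec-cong U (suc i) eq = ∑-cong U (λ x → ∑Vec-cong U i (eq ∘ (x ∷_)))

  ∑Vec-+ : ∀ (U : List A) i (f g : Vec A i → ℕ) → ∑Vec U i (λ e → f e + g e) ≡ ∑Vec U i f + ∑Vec U i g
  ∑Vec-+ U zero f g = refl
  ∑Vec-+ U (suc i) f g =
    trans (∑-cong U (λ x → ∑Vec-+ U i (f ∘ (x ∷_)) (g ∘ (x ∷_)))) (∑-+ U _ _)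

  ∑Vec-*ˡ : ∀ (U : List A) i (c : ℕ) (f : Vec A i → ℕ) → ∑Vec U i (λ e → c * f e) ≡ c * ∑Vec U i f
  ∑Vec-*ˡ U zero c f = refl
  ∑Vec-*ˡ U (suc i) c f = trans (∑-cong U (λ x → ∑Vec-*ˡ U i c (f ∘ (x ∷_)))) (∑-*ˡ U c _)

  SetInvariant : (List A → ℕ) → Set
  SetInvariant Q = ∀ {S S'} → S ⊆ S' → S' ⊆ S → Q S ≡ Q S'

  SetInvariant-∷ : ∀ {Q : List A → ℕ} y → SetInvariant Q → SetInvariant (Q ∘ (y ∷_))
  SetInvariant-∷ y inv p q = inv (∷⁺ʳ y p) (∷⁺ʳ y q)

  -- Adding x to a k-subset S gives S back when x ∈ S (k choices of x),
  -- and otherwise a (k+1)-subset, each of which arises k+1 times.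
  ∑-∑Subsets-∷ : ∀ (U : List A) k (Q : List A → ℕ) → SetInvariant Q →
    ∑ U (λ x → ∑Subsets U k (Q ∘ (x ∷_))) ≡ k * ∑Subsets U k Q + suc k * ∑Subsets U (suc k) Q
  ∑-∑Subsets-∷ [] zero Q inv = refl
  ∑-∑Subsets-∷ [] (suc k) Q inv = sym (cong₂ _+_ (ℕ.*-zeroʳ (suc k)) (ℕ.*-zeroʳ (suc (suc k))))
  ∑-∑Subsets-∷ (y ∷ U) zero Q inv = begin
      Q (y ∷ []) + ∑ U (λ x → Q (x ∷ []))
    ≡⟨ cong (_+_ (Q (y ∷ []))) (∑-∑Subsets-∷ U zero Q inv) ⟩
      Q (y ∷ []) + (0 + 1 * ∑Subsets U 1 Q)
    ≡⟨ rearrange (Q (y ∷ [])) (∑Subsets U 1 Q) ⟩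
      0 + 1 * (∑Subsets U 1 Q + Q (y ∷ []))
    ∎
    where
    open ≡-Reasoning
    rearrange : ∀ q s → q + (0 + 1 * s) ≡ 0 + 1 * (s + q)
    rearrange = ℕ-Solver.solve-∀
  ∑-∑Subsets-∷ (y ∷ U) (suc j) Q inv = begin
      (c + ∑Subsets U j (λ S → Q (y ∷ y ∷ S)))
        + ∑ U (λ x → ∑Subsets U k (Q ∘ (x ∷_)) + ∑Subsets U j (λ S → Q (x ∷ y ∷ S)))
    ≡⟨ cong₂ _+_ (cong (_+_ c) (∑Subsets-cong U j duplicate))
         (trans (∑-+ U _ _) (cong (_+_ (∑ U (λ x → ∑Subsets U k (Q ∘ (x ∷_)))))
           (∑-cong U (λ x → ∑Subsets-cong U j (swap x))))) ⟩
      (c + b) + (∑ U (λ x → ∑Subsets U k (Q ∘ (x ∷_))) + ∑ U (λ x → ∑Subsets U j (λ S → Q (y ∷ x ∷ S))))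
    ≡⟨ cong₂ (λ s t → (c + b) + (s + t))
         (∑-∑Subsets-∷ U k Q inv) (∑-∑Subsets-∷ U j (Q ∘ (y ∷_)) (SetInvariant-∷ y inv)) ⟩
      (c + b) + ((k * a + suc k * d) + (j * b + k * c))
    ≡⟨ rearrange j a b c d ⟩
      k * (a + b) + suc k * (d + c)
    ∎
    where
    open ≡-Reasoning
    k a b c d : ℕ
    k = suc j
    a = ∑Subsets U k Q
    b = ∑Subsets U j (Q ∘ (y ∷_))
    c = ∑Subsets U k (Q ∘ (y ∷_))
    d = ∑Subsets U (suc k) Q
    duplicate : ∀ S → Q (y ∷ y ∷ S) ≡ Q (y ∷ S)
    duplicate S = inv (∈-∷⁺ʳ (here refl) ⊆-refl) (xs⊆x∷xs (y ∷ S) y)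
    rearrange : ∀ j a b c d → (c + b) + ((suc j * a + suc (suc j) * d) + (j * b + suc j * c))
                              ≡ suc j * (a + b) + suc (suc j) * (d + c)
    rearrange = ℕ-Solver.solve-∀
    swap : ∀ x S → Q (x ∷ y ∷ S) ≡ Q (y ∷ x ∷ S)
    swap x S = inv (∈-∷⁺ʳ (there (here refl)) (∷⁺ʳ y (xs⊆x∷xs S x)))
                   (∈-∷⁺ʳ (there (here refl)) (∷⁺ʳ x (xs⊆x∷xs S y)))

∑ℤ : {A : Set} → List A → (A → ℤ) → ℤ
∑ℤ [] f = + 0
∑ℤ (x ∷ xs) f = f x ℤ.+ ∑ℤ xs f

module _ {A : Set} where

  ∑ℤ-cong : ∀ (xs : List A) {f g : A → ℤ} → (∀ x → f x ≡ g x) → ∑ℤ xs f ≡ ∑ℤ xs g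
  ∑ℤ-cong [] eq = refl
  ∑ℤ-cong (x ∷ xs) eq = cong₂ ℤ._+_ (eq x) (∑ℤ-cong xs eq)

  ∑ℤ-0 : ∀ (xs : List A) → ∑ℤ xs (λ _ → + 0) ≡ + 0
  ∑ℤ-0 [] = refl
  ∑ℤ-0 (x ∷ xs) = trans (ℤ.+-identityˡ _) (∑ℤ-0 xs)

  ∑ℤ-+ : ∀ (xs : List A) (f g : A → ℤ) → ∑ℤ xs (λ x → f x ℤ.+ g x) ≡ ∑ℤ xs f ℤ.+ ∑ℤ xs g
  ∑ℤ-+ [] f g = refl
  ∑ℤ-+ (x ∷ xs) f g = trans (cong (ℤ._+_ (f x ℤ.+ g x)) (∑ℤ-+ xs f g)) (ℤ+.interchange (f x) (g x) _ _)

  ∑ℤ-*ˡ : ∀ (xs : List A) (c : ℤ) (f : A → ℤ) → ∑ℤ xs (λ x → c ℤ.* f x) ≡ c ℤ.* ∑ℤ xs f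
  ∑ℤ-*ˡ [] c f = sym (ℤ.*-zeroʳ c)
  ∑ℤ-*ˡ (x ∷ xs) c f = trans (cong (ℤ._+_ (c ℤ.* f x)) (∑ℤ-*ˡ xs c f)) (sym (ℤ.*-distribˡ-+ c (f x) _))

  +-∑ : ∀ (xs : List A) (f : A → ℕ) → + ∑ xs f ≡ ∑ℤ xs (+_ ∘ f)
  +-∑ [] f = refl
  +-∑ (x ∷ xs) f = trans (ℤ.pos-+ (f x) (∑ xs f)) (cong (ℤ._+_ (+ f x)) (+-∑ xs f))

∑ℤ< : ℕ → (ℕ → ℤ) → ℤ
∑ℤ< zero f = + 0
∑ℤ< (suc n) f = f 0 ℤ.+ ∑ℤ< n (f ∘ suc)

∑ℤ<-cong : ∀ n {f g : ℕ → ℤ} → (∀ i → f i ≡ g i) → ∑ℤ< n f ≡ ∑ℤ< n g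
∑ℤ<-cong zero eq = refl
∑ℤ<-cong (suc n) eq = cong₂ ℤ._+_ (eq 0) (∑ℤ<-cong n (eq ∘ suc))

∑ℤ<-suc : ∀ n (f : ℕ → ℤ) → ∑ℤ< (suc n) f ≡ ∑ℤ< n f ℤ.+ f n
∑ℤ<-suc zero f = trans (ℤ.+-identityʳ (f 0)) (sym (ℤ.+-identityˡ (f 0)))
∑ℤ<-suc (suc n) f = trans (cong (ℤ._+_ (f 0)) (∑ℤ<-suc n (f ∘ suc))) (sym (ℤ.+-assoc (f 0) _ _))

∑ℤ<-+ : ∀ n (f g : ℕ → ℤ) → ∑ℤ< n (λ i → f i ℤ.+ g i) ≡ ∑ℤ< n f ℤ.+ ∑ℤ< n g
∑ℤ<-+ zero f g = refl
∑ℤ<-+ (suc n) f g =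
  trans (cong (ℤ._+_ (f 0 ℤ.+ g 0)) (∑ℤ<-+ n (f ∘ suc) (g ∘ suc))) (ℤ+.interchange (f 0) (g 0) _ _)

∑ℤ<-*ˡ : ∀ n (c : ℤ) (f : ℕ → ℤ) → ∑ℤ< n (λ i → c ℤ.* f i) ≡ c ℤ.* ∑ℤ< n f
∑ℤ<-*ˡ zero c f = sym (ℤ.*-zeroʳ c)
∑ℤ<-*ˡ (suc n) c f =
  trans (cong (ℤ._+_ (c ℤ.* f 0)) (∑ℤ<-*ˡ n c (f ∘ suc))) (sym (ℤ.*-distribˡ-+ c (f 0) _))

∑ℤ<-∑ℤ-comm : ∀ {A : Set} n (xs : List A) (h : ℕ → A → ℤ) →
  ∑ℤ< n (λ i → ∑ℤ xs (h i)) ≡ ∑ℤ xs (λ x → ∑ℤ< n (λ i → h i x))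
∑ℤ<-∑ℤ-comm zero xs h = sym (∑ℤ-0 xs)
∑ℤ<-∑ℤ-comm (suc n) xs h =
  trans (cong (ℤ._+_ (∑ℤ xs (h 0))) (∑ℤ<-∑ℤ-comm n xs (h ∘ suc))) (sym (∑ℤ-+ xs (h 0) _))

sum1to≡∑ℤ< : ∀ k (f : ℕ → ℤ) → sum1to k f ≡ ∑ℤ< k (f ∘ suc)
sum1to≡∑ℤ< zero f = refl
sum1to≡∑ℤ< (suc k) f = trans (cong (ℤ._+ f (suc k)) (sum1to≡∑ℤ< k f)) (sym (∑ℤ<-suc k (f ∘ suc)))

signedStirling : ℕ → ℕ → ℤ
signedStirling k i = sgn (k ∸ i) ℤ.* + stirling1 k i

stirling1-vanishes : ∀ {k i} → k < i → stirling1 k i ≡ 0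
stirling1-vanishes {zero} {suc i} _ = refl
stirling1-vanishes {suc k} {suc i} (s≤s k<i)
  rewrite stirling1-vanishes (ℕ.m<n⇒m<1+n k<i) | stirling1-vanishes k<i =
  trans (ℕ.+-identityʳ (k * 0)) (ℕ.*-zeroʳ k)

signedStirling-vanishes : ∀ {k i} → k < i → signedStirling k i ≡ + 0
signedStirling-vanishes {k} {i} k<i =
  trans (cong (λ c → sgn (k ∸ i) ℤ.* + c) (stirling1-vanishes k<i)) (ℤ.*-zeroʳ (sgn (k ∸ i)))

signedStirling-suc-zero : ∀ k → signedStirling (suc k) 0 ≡ + 0
signedStirling-suc-zero k = ℤ.*-zeroʳ (sgn (suc k))

*-signedStirling-zero : ∀ k → + k ℤ.* signedStirling k 0 ≡ + 0
*-signedStirling-zero zero = refl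
*-signedStirling-zero (suc k) = trans (cong (ℤ._*_ (+ suc k)) (signedStirling-suc-zero k)) (ℤ.*-zeroʳ (+ suc k))

sgn-∸-suc : ∀ {i k} → i < k → sgn (k ∸ i) ≡ ℤ.- sgn (k ∸ suc i)
sgn-∸-suc i<k = cong sgn (ℕ.+-∸-assoc 1 i<k)

signedStirling-suc : ∀ k i →
  signedStirling (suc k) (suc i) ≡ signedStirling k i ℤ.- + k ℤ.* signedStirling k (suc i)
signedStirling-suc k i = begin
    sgn (k ∸ i) ℤ.* + (k * stirling1 k (suc i) + stirling1 k i)
  ≡⟨ cong (ℤ._*_ (sgn (k ∸ i))) (trans (ℤ.pos-+ (k * stirling1 k (suc i)) _)
       (cong (ℤ._+ + stirling1 k i) (ℤ.pos-* k (stirling1 k (suc i))))) ⟩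
    sgn (k ∸ i) ℤ.* (+ k ℤ.* + stirling1 k (suc i) ℤ.+ + stirling1 k i)
  ≡⟨ distribute (sgn (k ∸ i)) (+ k) (+ stirling1 k (suc i)) (+ stirling1 k i) ⟩
    signedStirling k i ℤ.+ sgn (k ∸ i) ℤ.* (+ k ℤ.* + stirling1 k (suc i))
  ≡⟨ cong (ℤ._+_ (signedStirling k i)) (higherTerm (ℕ.<-≤-connex i k)) ⟩
    signedStirling k i ℤ.- + k ℤ.* signedStirling k (suc i)
  ∎
  where
  open ≡-Reasoning
  distribute : ∀ g a b c → g ℤ.* (a ℤ.* b ℤ.+ c) ≡ g ℤ.* c ℤ.+ g ℤ.* (a ℤ.* b)
  distribute = ℤ-Solver.solve-∀
  higherTerm : i < k ⊎ k ≤ i →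
    sgn (k ∸ i) ℤ.* (+ k ℤ.* + stirling1 k (suc i)) ≡ ℤ.- (+ k ℤ.* signedStirling k (suc i))
  higherTerm (inj₁ i<k) = trans (cong (ℤ._* (+ k ℤ.* + stirling1 k (suc i))) (sgn-∸-suc i<k))
    (negate (sgn (k ∸ suc i)) (+ k) (+ stirling1 k (suc i)))
    where
    negate : ∀ g a b → ℤ.- g ℤ.* (a ℤ.* b) ≡ ℤ.- (a ℤ.* (g ℤ.* b))
    negate = ℤ-Solver.solve-∀
  higherTerm (inj₂ k≤i) rewrite stirling1-vanishes (s≤s k≤i) = vanish (sgn (k ∸ i)) (+ k) (sgn (k ∸ suc i))
    where
    vanish : ∀ g a h → g ℤ.* (a ℤ.* + 0) ≡ ℤ.- (a ℤ.* (h ℤ.* + 0))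
    vanish = ℤ-Solver.solve-∀

∑ℤ<-signedStirling-suc : ∀ k n (f : ℕ → ℤ) →
  ∑ℤ< (suc n) (λ i → signedStirling (suc k) i ℤ.* f i)
  ≡ ∑ℤ< n (λ i → signedStirling k i ℤ.* f (suc i))
    ℤ.- + k ℤ.* ∑ℤ< (suc n) (λ i → signedStirling k i ℤ.* f i)
∑ℤ<-signedStirling-suc k n f = begin
    signedStirling (suc k) 0 ℤ.* f 0 ℤ.+ ∑ℤ< n (λ i → signedStirling (suc k) (suc i) ℤ.* f (suc i))
  ≡⟨ cong₂ ℤ._+_ (cong (ℤ._* f 0) (signedStirling-suc-zero k))
       (∑ℤ<-cong n (λ i → cong (ℤ._* f (suc i)) (signedStirling-suc k i))) ⟩
    + 0 ℤ.* f 0 ℤ.+ ∑ℤ< n (λ i → (s i ℤ.- + k ℤ.* s (suc i)) ℤ.* f (suc i))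
  ≡⟨ cong (ℤ._+_ (+ 0 ℤ.* f 0)) (trans (∑ℤ<-cong n (λ i → split (s i) (+ k) (s (suc i)) (f (suc i))))
       (trans (∑ℤ<-+ n _ _) (cong (ℤ._+_ A) (∑ℤ<-*ˡ n (ℤ.- + k) _)))) ⟩
    + 0 ℤ.* f 0 ℤ.+ (A ℤ.+ ℤ.- + k ℤ.* B)
  ≡⟨ cong (λ t → t ℤ.* f 0 ℤ.+ (A ℤ.+ ℤ.- + k ℤ.* B)) (sym (cong ℤ.-_ (*-signedStirling-zero k))) ⟩
    ℤ.- (+ k ℤ.* s 0) ℤ.* f 0 ℤ.+ (A ℤ.+ ℤ.- + k ℤ.* B)
  ≡⟨ collect A B (+ k) (s 0) (f 0) ⟩
    A ℤ.- + k ℤ.* (s 0 ℤ.* f 0 ℤ.+ B)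
  ∎
  where
  open ≡-Reasoning
  s : ℕ → ℤ
  s = signedStirling k
  A B : ℤ
  A = ∑ℤ< n (λ i → s i ℤ.* f (suc i))
  B = ∑ℤ< n (λ i → s (suc i) ℤ.* f (suc i))
  split : ∀ a k b c → (a ℤ.- k ℤ.* b) ℤ.* c ≡ a ℤ.* c ℤ.+ ℤ.- k ℤ.* (b ℤ.* c)
  split = ℤ-Solver.solve-∀
  collect : ∀ a b k t c → ℤ.- (k ℤ.* t) ℤ.* c ℤ.+ (a ℤ.+ ℤ.- k ℤ.* b) ≡ a ℤ.- k ℤ.* (t ℤ.* c ℤ.+ b)
  collect = ℤ-Solver.solve-∀

∑ℤ<-signedStirling-extend : ∀ k (f : ℕ → ℤ) →
  ∑ℤ< (suc (suc k)) (λ i → signedStirling k i ℤ.* f i) ≡ ∑ℤ< (suc k) (λ i → signedStirling k i ℤ.* f i)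
∑ℤ<-signedStirling-extend k f = begin
    ∑ℤ< (suc (suc k)) (λ i → signedStirling k i ℤ.* f i)
  ≡⟨ ∑ℤ<-suc (suc k) (λ i → signedStirling k i ℤ.* f i) ⟩
    ∑ℤ< (suc k) (λ i → signedStirling k i ℤ.* f i) ℤ.+ signedStirling k (suc k) ℤ.* f (suc k)
  ≡⟨ cong (λ t → ∑ℤ< (suc k) (λ i → signedStirling k i ℤ.* f i) ℤ.+ t ℤ.* f (suc k))
       (signedStirling-vanishes (ℕ.n<1+n k)) ⟩
    ∑ℤ< (suc k) (λ i → signedStirling k i ℤ.* f i) ℤ.+ + 0
  ≡⟨ ℤ.+-identityʳ _ ⟩
    ∑ℤ< (suc k) (λ i → signedStirling k i ℤ.* f i)
  ∎
  where open ≡-Reasoning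

∑ℤ<-*-∑ : ∀ {A : Set} n (c : ℕ → ℤ) (U : List A) (h : ℕ → A → ℕ) →
  ∑ℤ< n (λ i → c i ℤ.* + ∑ U (h i)) ≡ ∑ℤ U (λ x → ∑ℤ< n (λ i → c i ℤ.* + h i x))
∑ℤ<-*-∑ n c U h = trans
  (∑ℤ<-cong n (λ i → trans (cong (ℤ._*_ (c i)) (+-∑ U (h i))) (sym (∑ℤ-*ˡ U (c i) (+_ ∘ h i)))))
  (∑ℤ<-∑ℤ-comm n U (λ i x → c i ℤ.* + h i x))

factorial-step : ∀ k a b → + (k ! * (k * a + suc k * b)) ℤ.- + k ℤ.* + (k ! * a) ≡ + (suc k ! * b)
factorial-step k a b = begin
    + (k ! * (k * a + suc k * b)) ℤ.- + k ℤ.* + (k ! * a)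
  ≡⟨ cong (ℤ._- + k ℤ.* + (k ! * a)) (trans (cong +_ (expand k (k !) a b))
       (trans (ℤ.pos-+ (k * (k ! * a)) _) (cong (ℤ._+ + (suc k ! * b)) (ℤ.pos-* k (k ! * a))))) ⟩
    + k ℤ.* + (k ! * a) ℤ.+ + (suc k ! * b) ℤ.- + k ℤ.* + (k ! * a)
  ≡⟨ cancel (+ k ℤ.* + (k ! * a)) (+ (suc k ! * b)) ⟩
    + (suc k ! * b)
  ∎
  where
  open ≡-Reasoning
  expand : ∀ k f a b → f * (k * a + suc k * b) ≡ k * (f * a) + suc k * f * b
  expand = ℕ-Solver.solve-∀
  cancel : ∀ x y → x ℤ.+ y ℤ.- x ≡ y
  cancel = ℤ-Solver.solve-∀

stirling-inversion : ∀ {A : Set} (U : List A) k (Q : List A → ℕ) → SetInvariant Q →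
  + (k ! * ∑Subsets U k Q) ≡ ∑ℤ< (suc k) (λ i → signedStirling k i ℤ.* + ∑Vec U i (Q ∘ toList))
stirling-inversion U zero Q inv =
  trans (cong +_ (ℕ.+-identityʳ (Q []))) (sym (trans (ℤ.+-identityʳ _) (ℤ.*-identityˡ (+ Q []))))
stirling-inversion {A} U (suc k) Q inv = sym (begin
    ∑ℤ< (suc (suc k)) (λ i → signedStirling (suc k) i ℤ.* T Q i)
  ≡⟨ ∑ℤ<-signedStirling-suc k (suc k) (T Q) ⟩
    ∑ℤ< (suc k) (λ i → s i ℤ.* T Q (suc i)) ℤ.- + k ℤ.* ∑ℤ< (suc (suc k)) (λ i → s i ℤ.* T Q i)
  ≡⟨ cong₂ (λ a b → a ℤ.- + k ℤ.* b)
       (∑ℤ<-*-∑ (suc k) s U (λ i x → ∑Vec U i ((Q ∘ (x ∷_)) ∘ toList)))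
       (∑ℤ<-signedStirling-extend k (T Q)) ⟩
    ∑ℤ U (λ x → ∑ℤ< (suc k) (λ i → s i ℤ.* T (Q ∘ (x ∷_)) i))
      ℤ.- + k ℤ.* ∑ℤ< (suc k) (λ i → s i ℤ.* T Q i)
  ≡⟨ cong₂ (λ a b → a ℤ.- + k ℤ.* b)
       (∑ℤ-cong U (λ x → sym (stirling-inversion U k (Q ∘ (x ∷_)) (SetInvariant-∷ x inv))))
       (sym (stirling-inversion U k Q inv)) ⟩
    ∑ℤ U (λ x → + (k ! * ∑Subsets U k (Q ∘ (x ∷_)))) ℤ.- + k ℤ.* + (k ! * ∑Subsets U k Q)
  ≡⟨ cong (ℤ._- + k ℤ.* + (k ! * ∑Subsets U k Q)) (sym (trans
       (cong (λ t → + (k ! * t)) (sym (∑-∑Subsets-∷ U k Q inv)))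
       (trans (cong +_ (sym (∑-*ˡ U (k !) _))) (+-∑ U _)))) ⟩
    + (k ! * (k * ∑Subsets U k Q + suc k * ∑Subsets U (suc k) Q)) ℤ.- + k ℤ.* + (k ! * ∑Subsets U k Q)
  ≡⟨ factorial-step k (∑Subsets U k Q) (∑Subsets U (suc k) Q) ⟩
    + (suc k ! * ∑Subsets U (suc k) Q)
  ∎)
  where
  open ≡-Reasoning
  s : ℕ → ℤ
  s = signedStirling k
  T : (List A → ℕ) → ℕ → ℤ
  T R i = + ∑Vec U i (R ∘ toList)

fallingFactorial : ℕ → ℕ → ℕ
fallingFactorial n zero = 1
fallingFactorial n (suc k) = fallingFactorial n k * (n ∸ k)

fallingFactorial-*-! : ∀ n k → k ≤ n → fallingFactorial n k * (n ∸ k) ! ≡ n !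
fallingFactorial-*-! n zero _ = ℕ.+-identityʳ (n !)
fallingFactorial-*-! n (suc k) k<n = begin
    fallingFactorial n k * (n ∸ k) * (n ∸ suc k) !
  ≡⟨ ℕ.*-assoc (fallingFactorial n k) (n ∸ k) _ ⟩
    fallingFactorial n k * ((n ∸ k) * (n ∸ suc k) !)
  ≡⟨ cong (fallingFactorial n k *_) ([n-k]*[n-k-1]!≡[n-k]! k<n) ⟩
    fallingFactorial n k * (n ∸ k) !
  ≡⟨ fallingFactorial-*-! n k (ℕ.<⇒≤ k<n) ⟩
    n !
  ∎
  where open ≡-Reasoning

fallingFactorial-vanishes : ∀ n k → n < k → fallingFactorial n k ≡ 0
fallingFactorial-vanishes n (suc k) (s≤s n≤k) with ℕ.m≤n⇒m<n∨m≡n n≤k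
... | inj₁ n<k = cong (_* (n ∸ k)) (fallingFactorial-vanishes n k n<k)
... | inj₂ refl = trans (cong (fallingFactorial n n *_) (ℕ.n∸n≡0 n)) (ℕ.*-zeroʳ (fallingFactorial n n))

fallingFactorial≡!*C : ∀ n k → fallingFactorial n k ≡ k ! * (n C k)
fallingFactorial≡!*C n k with ℕ.≤-<-connex k n
... | inj₂ n<k = trans (fallingFactorial-vanishes n k n<k)
  (sym (trans (cong (k ! *_) (k>n⇒nCk≡0 n<k)) (ℕ.*-zeroʳ (k !))))
... | inj₁ k≤n = ℕ.*-cancelʳ-≡ _ _ ((n ∸ k) !) {{ℕ._!≢0 (n ∸ k)}}
  (trans (fallingFactorial-*-! n k k≤n) (sym !*C*!≡!))
  where
  instance _ = ℕ._!*_!≢0 k (n ∸ k)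
  !*C*!≡! : k ! * (n C k) * (n ∸ k) ! ≡ n !
  !*C*!≡! = begin
      k ! * (n C k) * (n ∸ k) !
    ≡⟨ ℕ*.xy∙z≈y∙xz (k !) (n C k) ((n ∸ k) !) ⟩
      (n C k) * (k ! * (n ∸ k) !)
    ≡⟨ cong (_* (k ! * (n ∸ k) !)) (nCk≡n!/k![n-k]! k≤n) ⟩
      n ! ℕ./ (k ! * (n ∸ k) !) * (k ! * (n ∸ k) !)
    ≡⟨ m/n*n≡m (k![n∸k]!∣n! k≤n) ⟩
      n !
    ∎
    where open ≡-Reasoning

injective-resp : ∀ {X Y : Set} {f g : X → Y} →
  (∀ x → f x ≡ g x) → Injective _≡_ _≡_ f → Injective _≡_ _≡_ g
injective-resp f≗g inj {x} {y} eq = inj (trans (f≗g x) (trans eq (sym (f≗g y))))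

module _ {X : Set} {n : ℕ} (r : Fin n → X) (i : Fin (suc n)) (v : X) where

  insertAt-punchOut : ∀ {j} (i≢j : i ≢ j) → insertAt r i v j ≡ r (punchOut i≢j)
  insertAt-punchOut i≢j =
    trans (cong (insertAt r i v) (sym (Fin.punchIn-punchOut i≢j))) (insertAt-punchIn r i v _)

  insertAt-injective : Injective _≡_ _≡_ r → (∀ j → v ≢ r j) → Injective _≡_ _≡_ (insertAt r i v)
  insertAt-injective inj v∉r {j} {j'} eq with i Fin.≟ j | i Fin.≟ j'
  ... | yes refl | yes refl = refl
  ... | yes refl | no i≢j' =
    ⊥-elim (v∉r _ (trans (sym (insertAt-lookup r i v)) (trans eq (insertAt-punchOut i≢j'))))
  ... | no i≢j | yes refl =
    ⊥-elim (v∉r _ (trans (sym (insertAt-lookup r i v)) (trans (sym eq) (insertAt-punchOut i≢j))))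
  ... | no i≢j | no i≢j' = Fin.punchOut-injective i≢j i≢j'
    (inj (trans (sym (insertAt-punchOut i≢j)) (trans eq (insertAt-punchOut i≢j'))))

  insertAt-injective⁻ : Injective _≡_ _≡_ (insertAt r i v) → Injective _≡_ _≡_ r × (∀ j → v ≢ r j)
  insertAt-injective⁻ inj =
      (λ {j} {j'} eq → Fin.punchIn-injective i j j'
        (inj (trans (insertAt-punchIn r i v j) (trans eq (sym (insertAt-punchIn r i v j'))))))
    , (λ j eq → Fin.punchInᵢ≢i i j
        (sym (inj (trans (insertAt-lookup r i v) (trans eq (sym (insertAt-punchIn r i v j)))))))

bools : List Bool
bools = false ∷ true ∷ []

_≟ᵛ_ : ∀ {i} → (u v : Vec Bool i) → Dec (u ≡ v)
_≟ᵛ_ = Vec.≡-dec _≟ᴮ_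

∑Vec-bools-1 : ∀ i → ∑Vec bools i (λ _ → 1) ≡ 2 ^ i
∑Vec-bools-1 zero = refl
∑Vec-bools-1 (suc i) rewrite ∑Vec-bools-1 i = refl

∑Vec-bools-δ : ∀ i (v : Vec Bool i) (g : Vec Bool i → ℕ) →
  ∑Vec bools i (λ u → indicator (u ≟ᵛ v) * g u) ≡ g v
∑Vec-bools-δ zero [] g = ℕ.+-identityʳ (g [])
∑Vec-bools-δ (suc i) (c ∷ v) g = begin
    ∑ bools (λ x → ∑Vec bools i (λ u → indicator ((x ∷ u) ≟ᵛ (c ∷ v)) * g (x ∷ u)))
  ≡⟨ ∑-cong bools (λ x → trans (∑Vec-cong bools i (λ u → trans (cong (_* g (x ∷ u)) (indicator-∷ x u))
                                                     (ℕ.*-assoc (indicator (x ≟ᴮ c)) _ (g (x ∷ u)))))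
                         (trans (∑Vec-*ˡ bools i (indicator (x ≟ᴮ c)) _)
                                (cong (indicator (x ≟ᴮ c) *_) (∑Vec-bools-δ i v (g ∘ (x ∷_)))))) ⟩
    ∑ bools (λ x → indicator (x ≟ᴮ c) * g (x ∷ v))
  ≡⟨ at c ⟩
    g (c ∷ v)
  ∎
  where
  open ≡-Reasoning
  indicator-∷ : ∀ x u → indicator ((x ∷ u) ≟ᵛ (c ∷ v)) ≡ indicator (x ≟ᴮ c) * indicator (u ≟ᵛ v)
  indicator-∷ x u = trans
    (indicator-cong (λ eq → Vec.∷-injectiveˡ eq , Vec.∷-injectiveʳ eq) (λ (p , q) → cong₂ _∷_ p q)
      ((x ∷ u) ≟ᵛ (c ∷ v)) ((x ≟ᴮ c) ×-dec (u ≟ᵛ v)))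
    (indicator-× (x ≟ᴮ c) (u ≟ᵛ v))
  at : ∀ c → ∑ bools (λ x → indicator (x ≟ᴮ c) * g (x ∷ v)) ≡ g (c ∷ v)
  at false = trans (ℕ.+-identityʳ _) (ℕ.+-identityʳ _)
  at true = trans (ℕ.+-identityʳ _) (ℕ.+-identityʳ _)

Avoids : ∀ {n i} → (Fin n → Vec Bool i) → Vec Bool i → Set
Avoids r u = ∀ j → u ≢ r j

avoids? : ∀ {n i} (r : Fin n → Vec Bool i) (u : Vec Bool i) → Dec (Avoids r u)
avoids? r u = Fin.all? (λ j → ¬? (u ≟ᵛ r j))

-- Dropping r 0 from an injective r frees exactly the one vector r 0.
∑Vec-avoids-tail : ∀ {n} i (r : Fin (suc n) → Vec Bool i) → Injective _≡_ _≡_ r →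
  ∑Vec bools i (indicator ∘ avoids? (r ∘ fsuc)) ≡ suc (∑Vec bools i (indicator ∘ avoids? r))
∑Vec-avoids-tail i r inj = begin
    ∑Vec bools i (indicator ∘ avoids? (r ∘ fsuc))
  ≡⟨ ∑Vec-cong bools i split ⟩
    ∑Vec bools i (λ u → indicator (u ≟ᵛ r fzero) * indicator (avoids? (r ∘ fsuc) u) + indicator (avoids? r u))
  ≡⟨ ∑Vec-+ bools i _ _ ⟩
    ∑Vec bools i (λ u → indicator (u ≟ᵛ r fzero) * indicator (avoids? (r ∘ fsuc) u))
      + ∑Vec bools i (indicator ∘ avoids? r)
  ≡⟨ cong (_+ ∑Vec bools i (indicator ∘ avoids? r))
       (trans (∑Vec-bools-δ i (r fzero) (indicator ∘ avoids? (r ∘ fsuc)))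
              (indicator-yes (λ j eq → Fin.0≢1+n (inj eq)) (avoids? (r ∘ fsuc) (r fzero)))) ⟩
    suc (∑Vec bools i (indicator ∘ avoids? r))
  ∎
  where
  open ≡-Reasoning
  split : ∀ u → indicator (avoids? (r ∘ fsuc) u)
                ≡ indicator (u ≟ᵛ r fzero) * indicator (avoids? (r ∘ fsuc) u) + indicator (avoids? r u)
  split u = by-cases (u ≟ᵛ r fzero)
    where
    by-cases : (d : Dec (u ≡ r fzero)) →
      indicator (avoids? (r ∘ fsuc) u) ≡ indicator d * indicator (avoids? (r ∘ fsuc) u) + indicator (avoids? r u)
    by-cases (yes u≡r0) = trans (sym (ℕ.+-identityʳ _))
      (cong₂ _+_ (sym (ℕ.+-identityʳ _)) (sym (indicator-no (λ av → av fzero u≡r0) (avoids? r u))))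
    by-cases (no u≢r0) = indicator-cong
      (λ av → λ { fzero → u≢r0 ; (fsuc j) → av j }) (λ av j → av (fsuc j))
      (avoids? (r ∘ fsuc) u) (avoids? r u)

∑Vec-avoids : ∀ i n (r : Fin n → Vec Bool i) → Injective _≡_ _≡_ r →
  ∑Vec bools i (indicator ∘ avoids? r) ≡ 2 ^ i ∸ n
∑Vec-avoids i zero r inj = trans (∑Vec-cong bools i (λ u → indicator-yes (λ ()) (avoids? r u))) (∑Vec-bools-1 i)
∑Vec-avoids i (suc n) r inj = begin
    ∑Vec bools i (indicator ∘ avoids? r)
  ≡⟨ cong ℕ.pred (sym (∑Vec-avoids-tail i r inj)) ⟩
    ℕ.pred (∑Vec bools i (indicator ∘ avoids? (r ∘ fsuc)))
  ≡⟨ cong ℕ.pred (∑Vec-avoids i n (r ∘ fsuc) (Fin.suc-injective ∘ inj)) ⟩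
    ℕ.pred (2 ^ i ∸ n)
  ≡⟨ ℕ.pred[m∸n]≡m∸[1+n] (2 ^ i) n ⟩
    2 ^ i ∸ suc n
  ∎
  where open ≡-Reasoning

colours : ∀ {m i} → Vec (Bip m) i → Fin (suc m) → Vec Bool i
colours e j = Vec.map (λ b → colour b j) e

module _ {m : ℕ} where

  cuts⇒colours-≢ : ∀ {i} (e : Vec (Bip m) i) j j' →
    Any (λ b → Cuts b j j') (toList e) → colours e j ≢ colours e j'
  cuts⇒colours-≢ (b ∷ e) j j' (here cut) eq = cut (Vec.∷-injectiveˡ eq)
  cuts⇒colours-≢ (b ∷ e) j j' (there cuts) eq = cuts⇒colours-≢ e j j' cuts (Vec.∷-injectiveʳ eq)

  colours-≢⇒cuts : ∀ {i} (e : Vec (Bip m) i) j j' →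
    colours e j ≢ colours e j' → Any (λ b → Cuts b j j') (toList e)
  colours-≢⇒cuts [] j j' ne = ⊥-elim (ne refl)
  colours-≢⇒cuts (b ∷ e) j j' ne with colour b j ≟ᴮ colour b j'
  ... | no cut = here cut
  ... | yes eq = there (colours-≢⇒cuts e j j' (ne ∘ cong₂ _∷_ eq))

  separating⇒colours-injective : ∀ {i} (e : Vec (Bip m) i) → Separating (toList e) → Injective _≡_ _≡_ (colours e)
  separating⇒colours-injective e sep {j} {j'} eq with j Fin.≟ j'
  ... | yes j≡j' = j≡j'
  ... | no j≢j' = ⊥-elim (cuts⇒colours-≢ e j j' (sep j j' j≢j') eq)

  colours-injective⇒separating : ∀ {i} (e : Vec (Bip m) i) → Injective _≡_ _≡_ (colours e) → Separating (toList e)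
  colours-injective⇒separating e inj j j' j≢j' = colours-≢⇒cuts e j j' (j≢j' ∘ inj)

-- Extending each bipartition by a colour for a new element inserts that column at position 1,
-- because element 0 keeps the fixed colour false.
colours-zipWith : ∀ {m i} (bs : Vec Bool i) (ys : Vec (Bip m) i) j →
  colours (zipWith _∷_ bs ys) j ≡ insertAt (colours ys) (fsuc fzero) bs j
colours-zipWith [] [] fzero = refl
colours-zipWith [] [] (fsuc fzero) = refl
colours-zipWith [] [] (fsuc (fsuc j)) = refl
colours-zipWith (b ∷ bs) (y ∷ ys) fzero = cong (false ∷_) (colours-zipWith bs ys fzero)
colours-zipWith (b ∷ bs) (y ∷ ys) (fsuc fzero) = cong (b ∷_) (colours-zipWith bs ys (fsuc fzero))
colours-zipWith (b ∷ bs) (y ∷ ys) (fsuc (fsuc j)) = cong (_ ∷_) (colours-zipWith bs ys (fsuc (fsuc j)))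

module _ {m i : ℕ} (bs : Vec Bool i) (ys : Vec (Bip m) i) where

  separating-zipWith⁻ : Separating (toList (zipWith _∷_ bs ys)) → Separating (toList ys) × Avoids (colours ys) bs
  separating-zipWith⁻ sep with insertAt-injective⁻ (colours ys) (fsuc fzero) bs
                                 (injective-resp (colours-zipWith bs ys) (separating⇒colours-injective _ sep))
  ... | inj , avoids = colours-injective⇒separating ys inj , avoids

  separating-zipWith : Separating (toList ys) × Avoids (colours ys) bs → Separating (toList (zipWith _∷_ bs ys))
  separating-zipWith (sep , avoids) = colours-injective⇒separating (zipWith _∷_ bs ys)
    (injective-resp (sym ∘ colours-zipWith bs ys)
      (insertAt-injective (colours ys) (fsuc fzero) bs (separating⇒colours-injective ys sep) avoids))

∑-∑Vec-comm : ∀ {A B : Set} (xs : List B) (U : List A) i (h : B → Vec A i → ℕ) →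
  ∑ xs (λ x → ∑Vec U i (h x)) ≡ ∑Vec U i (λ e → ∑ xs (λ x → h x e))
∑-∑Vec-comm [] U i h = sym (∑Vec-*ˡ U i 0 (λ _ → 0))
∑-∑Vec-comm (x ∷ xs) U i h = trans (cong (_+_ (∑Vec U i (h x))) (∑-∑Vec-comm xs U i h)) (sym (∑Vec-+ U i _ _))

∑-allBips-suc : ∀ m (g : Bip (suc m) → ℕ) →
  ∑ (allBips (suc m)) g ≡ ∑ (allBips m) (λ y → ∑ bools (λ b → g (b ∷ y)))
∑-allBips-suc m g = begin
    ∑ (map (false ∷_) (allBips m) ++ map (true ∷_) (allBips m)) g
  ≡⟨ ∑-++ (map (false ∷_) (allBips m)) _ g ⟩
    ∑ (map (false ∷_) (allBips m)) g + ∑ (map (true ∷_) (allBips m)) g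
  ≡⟨ cong₂ _+_ (∑-map (false ∷_) (allBips m) g) (∑-map (true ∷_) (allBips m) g) ⟩
    ∑ (allBips m) (λ y → g (false ∷ y)) + ∑ (allBips m) (λ y → g (true ∷ y))
  ≡⟨ sym (∑-+ (allBips m) _ _) ⟩
    ∑ (allBips m) (λ y → g (false ∷ y) + g (true ∷ y))
  ≡⟨ ∑-cong (allBips m) (λ y → cong (_+_ (g (false ∷ y))) (sym (ℕ.+-identityʳ (g (true ∷ y))))) ⟩
    ∑ (allBips m) (λ y → ∑ bools (λ b → g (b ∷ y)))
  ∎
  where open ≡-Reasoning

∑Vec-allBips-suc : ∀ m i (f : Vec (Bip (suc m)) i → ℕ) →
  ∑Vec (allBips (suc m)) i f ≡ ∑Vec (allBips m) i (λ ys → ∑Vec bools i (λ bs → f (zipWith _∷_ bs ys)))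
∑Vec-allBips-suc m zero f = refl
∑Vec-allBips-suc m (suc i) f = begin
    ∑ (allBips (suc m)) (λ x → ∑Vec (allBips (suc m)) i (f ∘ (x ∷_)))
  ≡⟨ ∑-allBips-suc m _ ⟩
    ∑ (allBips m) (λ y → ∑ bools (λ b → ∑Vec (allBips (suc m)) i (f ∘ ((b ∷ y) ∷_))))
  ≡⟨ ∑-cong (allBips m) (λ y → ∑-cong bools (λ b → ∑Vec-allBips-suc m i (f ∘ ((b ∷ y) ∷_)))) ⟩
    ∑ (allBips m) (λ y → ∑ bools (λ b →
      ∑Vec (allBips m) i (λ ys → ∑Vec bools i (λ bs → f ((b ∷ y) ∷ zipWith _∷_ bs ys)))))
  ≡⟨ ∑-cong (allBips m) (λ y → ∑-∑Vec-comm bools (allBips m) i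
       (λ b ys → ∑Vec bools i (λ bs → f ((b ∷ y) ∷ zipWith _∷_ bs ys)))) ⟩
    ∑Vec (allBips m) (suc i) (λ ys → ∑Vec bools (suc i) (λ bs → f (zipWith _∷_ bs ys)))
  ∎
  where open ≡-Reasoning

separatingIndicator : ∀ {m} → List (Bip m) → ℕ
separatingIndicator F = indicator (separating? F)

separatingIndicator-setInvariant : ∀ {m} → SetInvariant (separatingIndicator {m})
separatingIndicator-setInvariant {S = S} {S'} S⊆S' S'⊆S = indicator-cong
  (λ sep j j' j≢j' → Any-resp-⊆ S⊆S' (sep j j' j≢j'))
  (λ sep j j' j≢j' → Any-resp-⊆ S'⊆S (sep j j' j≢j'))
  (separating? S) (separating? S')

separatingSequences : ℕ → ℕ → ℕ
separatingSequences m i = ∑Vec (allBips m) i (separatingIndicator ∘ toList)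

∑Vec-bools-separating-zipWith : ∀ {m i} (ys : Vec (Bip m) i) →
  ∑Vec bools i (λ bs → separatingIndicator (toList (zipWith _∷_ bs ys)))
  ≡ separatingIndicator (toList ys) * (2 ^ i ∸ suc m)
∑Vec-bools-separating-zipWith {m} {i} ys = begin
    ∑Vec bools i (λ bs → separatingIndicator (toList (zipWith _∷_ bs ys)))
  ≡⟨ ∑Vec-cong bools i (λ bs → trans
       (indicator-cong (separating-zipWith⁻ bs ys) (separating-zipWith bs ys)
         (separating? (toList (zipWith _∷_ bs ys))) (separating? (toList ys) ×-dec avoids? (colours ys) bs))
       (indicator-× (separating? (toList ys)) (avoids? (colours ys) bs))) ⟩
    ∑Vec bools i (λ bs → separatingIndicator (toList ys) * indicator (avoids? (colours ys) bs))
  ≡⟨ ∑Vec-*ˡ bools i (separatingIndicator (toList ys)) _ ⟩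
    separatingIndicator (toList ys) * ∑Vec bools i (indicator ∘ avoids? (colours ys))
  ≡⟨ count (separating? (toList ys)) ⟩
    separatingIndicator (toList ys) * (2 ^ i ∸ suc m)
  ∎
  where
  open ≡-Reasoning
  count : (d : Dec (Separating (toList ys))) →
    indicator d * ∑Vec bools i (indicator ∘ avoids? (colours ys)) ≡ indicator d * (2 ^ i ∸ suc m)
  count (yes sep) = cong (1 *_) (∑Vec-avoids i (suc m) (colours ys) (separating⇒colours-injective ys sep))
  count (no _) = refl

separatingSequences-suc : ∀ m i → separatingSequences (suc m) i ≡ separatingSequences m i * (2 ^ i ∸ suc m)
separatingSequences-suc m i = begin
    separatingSequences (suc m) i
  ≡⟨ ∑Vec-allBips-suc m i (separatingIndicator ∘ toList) ⟩
    ∑Vec (allBips m) i (λ ys → ∑Vec bools i (λ bs → separatingIndicator (toList (zipWith _∷_ bs ys))))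
  ≡⟨ ∑Vec-cong (allBips m) i (λ ys →
       trans (∑Vec-bools-separating-zipWith ys) (ℕ.*-comm _ (2 ^ i ∸ suc m))) ⟩
    ∑Vec (allBips m) i (λ ys → (2 ^ i ∸ suc m) * separatingIndicator (toList ys))
  ≡⟨ trans (∑Vec-*ˡ (allBips m) i (2 ^ i ∸ suc m) _) (ℕ.*-comm (2 ^ i ∸ suc m) _) ⟩
    separatingSequences m i * (2 ^ i ∸ suc m)
  ∎
  where open ≡-Reasoning

separatingSequences-zero : ∀ i → separatingSequences 0 i ≡ 1
separatingSequences-zero i =
  trans (∑Vec-cong (allBips 0) i (λ e → indicator-yes (separating-singleton e) (separating? (toList e)))) (ones i)
  where
  separating-singleton : ∀ {i} (e : Vec (Bip 0) i) → Separating (toList e)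
  separating-singleton e fzero fzero 0≢0 = ⊥-elim (0≢0 refl)
  ones : ∀ i → ∑Vec (allBips 0) i (λ _ → 1) ≡ 1
  ones zero = refl
  ones (suc i) = trans (ℕ.+-identityʳ _) (ones i)

separatingSequences≡fallingFactorial : ∀ m i → separatingSequences m i ≡ fallingFactorial (2 ^ i ∸ 1) m
separatingSequences≡fallingFactorial zero i = separatingSequences-zero i
separatingSequences≡fallingFactorial (suc m) i = trans (separatingSequences-suc m i)
  (cong₂ _*_ (separatingSequences≡fallingFactorial m i) (sym (ℕ.∸-+-assoc (2 ^ i) 1 m)))

τ≡∑Subsets : ∀ m k → τ m k ≡ ∑Subsets (allBips m) k separatingIndicator
τ≡∑Subsets m k = begin
    length (filter separating? (families m k))
  ≡⟨ length≡∑1 (filter separating? (families m k)) ⟩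
    ∑ (filter separating? (families m k)) (λ _ → 1)
  ≡⟨ ∑-filter separating? (families m k) (λ _ → 1) ⟩
    ∑ (families m k) (λ F → separatingIndicator F * 1)
  ≡⟨ ∑-filter (λ F → length F ℕ.≟ k) (sublists (allBips m)) _ ⟩
    ∑ (sublists (allBips m)) (λ F → indicator (length F ℕ.≟ k) * (separatingIndicator F * 1))
  ≡⟨ ∑-cong (sublists (allBips m)) (λ F → cong (indicator (length F ℕ.≟ k) *_) (ℕ.*-identityʳ _)) ⟩
    ∑ (sublists (allBips m)) (λ F → indicator (length F ℕ.≟ k) * separatingIndicator F)
  ≡⟨ ∑-sublists-length (allBips m) k separatingIndicator ⟩
    ∑Subsets (allBips m) k separatingIndicator
  ∎
  where open ≡-Reasoning

separatingSequences≡!*C : ∀ m i → separatingSequences m i ≡ m ! * ((2 ^ i ∸ 1) C m)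
separatingSequences≡!*C m i =
  trans (separatingSequences≡fallingFactorial m i) (fallingFactorial≡!*C (2 ^ i ∸ 1) m)

theorem3p8 : ∀ (m k : ℕ) → 1 ≤ m → 1 ≤ k → k ≤ 2 ^ m →
  + (k ! * τ m k)
  ≡ + (m !) ℤ.* sum1to k (λ i → sgn (k ∸ i) ℤ.* (+ stirling1 k i ℤ.* + ((2 ^ i ∸ 1) C m)))
-- The identity holds for every m; of the hypotheses only 1 ≤ k is needed.
theorem3p8 m k@(suc _) _ _ _ = begin
    + (k ! * τ m k)
  ≡⟨ cong (λ t → + (k ! * t)) (τ≡∑Subsets m k) ⟩
    + (k ! * ∑Subsets (allBips m) k separatingIndicator)
  ≡⟨ stirling-inversion (allBips m) k separatingIndicator separatingIndicator-setInvariant ⟩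
    ∑ℤ< (suc k) (λ i → signedStirling k i ℤ.* + separatingSequences m i)
  ≡⟨ ∑ℤ<-cong (suc k) (λ i → trans (cong (λ t → signedStirling k i ℤ.* + t) (separatingSequences≡!*C m i))
       (trans (cong (ℤ._*_ (signedStirling k i)) (ℤ.pos-* (m !) ((2 ^ i ∸ 1) C m)))
         (reorder (sgn (k ∸ i)) (+ stirling1 k i) (+ (m !)) (+ ((2 ^ i ∸ 1) C m))))) ⟩
    ∑ℤ< (suc k) (λ i → + (m !) ℤ.* term i)
  ≡⟨ ∑ℤ<-*ˡ (suc k) (+ (m !)) term ⟩
    + (m !) ℤ.* (term 0 ℤ.+ ∑ℤ< k (term ∘ suc))
  -- stirling1 k 0 = 0 as k ≥ 1
  ≡⟨ cong (λ t → + (m !) ℤ.* (t ℤ.+ ∑ℤ< k (term ∘ suc))) (ℤ.*-zeroʳ (sgn k)) ⟩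
    + (m !) ℤ.* (+ 0 ℤ.+ ∑ℤ< k (term ∘ suc))
  ≡⟨ cong (ℤ._*_ (+ (m !))) (trans (ℤ.+-identityˡ _) (sym (sum1to≡∑ℤ< k term))) ⟩
    + (m !) ℤ.* sum1to k term
  ∎
  where
  open ≡-Reasoning
  term : ℕ → ℤ
  term i = sgn (k ∸ i) ℤ.* (+ stirling1 k i ℤ.* + ((2 ^ i ∸ 1) C m))
  reorder : ∀ g c f b → (g ℤ.* c) ℤ.* (f ℤ.* b) ≡ f ℤ.* (g ℤ.* (c ℤ.* b))
  reorder = ℤ-Solver.solve-∀
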